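{- Let $S$ be a numerical monoid and let $H\subset\mathcal P_{\mathrm{fin},0}(S)$ be a divisor-closed submonoid with $H\ne\{\{0\}\}$. Then $H$ is neither torsion-free nor locally finitely generated. Moreover, there is no transfer homomorphism $\varphi\colon H\to B$ where $B$ is a cancellative monoid. In particular, $H$ is not transfer Krull.
   Context: A numerical monoid is an additive submonoid of $\mathbb N_0$ with $\gcd 1$. $\mathcal P_{\mathrm{fin},0}(S)$ is the monoid of finite subsets of $S$ containing $0$ under set addition (identity $\{0\}$, its only unit). All monoids here are commutative semigroups with identity that are unit-cancellative ($a=a+u$ implies $u$ invertible); $H^\times$ denotes the group of units. $a$ divides $b$ in $H$ if $b=a+c$ for some $c\in H$; a submonoid is divisor-closed if it contains all divisors of its elements; $[\![a]\!]$ is the set of elements dividing some multiple $na$, $n\in\mathbb N_0$. $H$ is torsion-free if $na=nb$ with $a,b\in H$, $n\in\mathbb N$ implies $a=b$. $H$ is locally finitely generated if $[\![a]\!]_{\mathrm{red}}=[\![a]\!]/H^\times$ is finitely generated for every $a\in H$. A monoid is cancellative if $a+b=a+c$ implies $b=c$. A monoid homomorphism $\theta\colon H\to B$ is a transfer homomorphism if (T1) $B=\theta(H)+B^\times$ and $\theta^{ -1}(B^\times)=H^\times$, and (T2) whenever $u\in H$, $b,c\in B$ and $\theta(u)=b+c$, there exist $v,w\in H$ with $u=v+w$, $\theta(v)\in b+B^\times$ and $\theta(w)\in c+B^\times$. A Krull monoid is a cancellative, completely integrally closed monoid satisfying the ascending chain condition on divisorial ideals; a monoid is transfer Krull if it admits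 a transfer homomorphism to a Krull monoid. -}

module Defs where

open import Level using (Level; _⊔_) renaming (zero to 0ℓ)
open import Data.Nat using (ℕ; zero; suc; _+_; _≥_)
open import Data.Nat.Divisibility using (_∣_)
open import Data.List using (List; []; _∷_; cartesianProductWith)
open import Data.List.Membership.Propositional using (_∈_)
open import Data.List.Membership.Propositional.Properties
  using (∈-cartesianProductWith⁺; ∈-cartesianProductWith⁻)
open import Data.List.Relation.Unary.Any using (here)
open import Data.Vec using (Vec; []; _∷_)
import Data.Vec.Relation.Unary.All as VecAll
open import Data.Product using (Σ; ∃; ∃-syntax; _×_; _,_)
open import Relation.Nullary using (¬_)
open import Relation.Binary.PropositionalEquality using (_≡_; refl; subst)
open import Algebra.Bundles using (CommutativeMonoid)
open import Algebra.Bundles.Raw using (RawMonoid)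

record NumericalMonoid : Set₁ where
  field
    S      : ℕ → Set
    0∈S    : S 0
    +-closed : ∀ {a b} → S a → S b → S (a + b)
    gcd≡1  : ∀ d → (∀ s → S s → d ∣ s) → d ≡ 1

-- P_fin,0(S): finite subsets of S containing 0, represented by a list
-- of their elements; two such sets are equal iff they have the same
-- elements.

module _ (N : NumericalMonoid) where
  open NumericalMonoid N

  record FinSet0 : Set where
    constructor mkFinSet0
    field
      elems : List ℕ
      ⊆S    : ∀ {n} → n ∈ elems → S n
      0∈    : 0 ∈ elems

  open FinSet0

  _≋_ : FinSet0 → FinSet0 → Set
  A ≋ B = ∀ n → (n ∈ elems A → n ∈ elems B) × (n ∈ elems B → n ∈ elems A)

  zeroSet : FinSet0
  zeroSet = mkFinSet0 (0 ∷ []) (λ { (here refl) → 0∈S ; (Data.List.Relation.Unary.Any.there ()) }) (here refl)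

  _⊕_ : FinSet0 → FinSet0 → FinSet0
  A ⊕ B = mkFinSet0 (cartesianProductWith _+_ (elems A) (elems B)) sub
                    (∈-cartesianProductWith⁺ _+_ (0∈ A) (0∈ B))
    where
    sub : ∀ {n} → n ∈ cartesianProductWith _+_ (elems A) (elems B) → S n
    sub p with ∈-cartesianProductWith⁻ _+_ (elems A) (elems B) p
    ... | a , b , a∈ , b∈ , refl = +-closed (⊆S A a∈) (⊆S B b∈)

  Pfin0 : RawMonoid 0ℓ 0ℓ
  Pfin0 = record { Carrier = FinSet0 ; _≈_ = _≋_ ; _∙_ = _⊕_ ; ε = zeroSet }

  record IsDivClosedSubmonoid (H : FinSet0 → Set) : Set where
    field
      resp     : ∀ {A B} → A ≋ B → H A → H B
      ε∈       : H zeroSet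
      ∙-closed : ∀ {A B} → H A → H B → H (A ⊕ B)
      divClosed : ∀ {A B C} → H A → A ≋ (B ⊕ C) → H B

  SubMonoid : (H : FinSet0 → Set) → IsDivClosedSubmonoid H → RawMonoid 0ℓ 0ℓ
  SubMonoid H h = record
    { Carrier = Σ FinSet0 H
    ; _≈_ = λ { (A , _) (B , _) → A ≋ B }
    ; _∙_ = λ { (A , a) (B , b) → (A ⊕ B) , ∙-closed a b }
    ; ε = zeroSet , ε∈ }
    where open IsDivClosedSubmonoid h

module _ {c ℓ : Level} (M : RawMonoid c ℓ) where
  open RawMonoid M

  _·_ : ℕ → Carrier → Carrier
  zero  · a = ε
  suc n · a = a ∙ (n · a)

  IsUnit : Carrier → Set (c ⊔ ℓ)
  IsUnit u = ∃[ v ] (u ∙ v ≈ ε)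

  Divides : Carrier → Carrier → Set (c ⊔ ℓ)
  Divides a b = ∃[ d ] (b ≈ a ∙ d)

  InDivHull : Carrier → Carrier → Set (c ⊔ ℓ)
  InDivHull a b = ∃[ n ] Divides b (n · a)

  TorsionFree : Set (c ⊔ ℓ)
  TorsionFree = ∀ (a b : Carrier) (n : ℕ) → n ≥ 1 → (n · a) ≈ (n · b) → a ≈ b

  lincomb : ∀ {k} → Vec ℕ k → Vec Carrier k → Carrier
  lincomb []       []       = ε
  lincomb (n ∷ ns) (g ∷ gs) = (n · g) ∙ lincomb ns gs

  -- [[a]]_red = [[a]]/H^× is finitely generated: there are finitely many
  -- g₁,…,g_k ∈ [[a]] such that every b ∈ [[a]] equals, up to a unit,
  -- a ℕ-linear combination of the gᵢ.
  ReducedDivHullFinGen : Carrier → Set (c ⊔ ℓ)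
  ReducedDivHullFinGen a =
    ∃[ k ] Σ (Vec Carrier k) λ gs →
      VecAll.All (InDivHull a) gs ×
      (∀ b → InDivHull a b →
         ∃[ ns ] ∃[ u ] (IsUnit u × b ≈ (lincomb ns gs ∙ u)))

  LocallyFinitelyGenerated : Set (c ⊔ ℓ)
  LocallyFinitelyGenerated = ∀ a → ReducedDivHullFinGen a

  Cancellative : Set (c ⊔ ℓ)
  Cancellative = ∀ a b d → (a ∙ b) ≈ (a ∙ d) → b ≈ d

Cancellativeᶜ : {c ℓ : Level} → CommutativeMonoid c ℓ → Set (c ⊔ ℓ)
Cancellativeᶜ B = Cancellative (CommutativeMonoid.rawMonoid B)

module _ {c₁ ℓ₁ c₂ ℓ₂ : Level} (H : RawMonoid c₁ ℓ₁) (B : RawMonoid c₂ ℓ₂) where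
  private
    module H = RawMonoid H
    module B = RawMonoid B

  record IsMonoidHom (θ : H.Carrier → B.Carrier) : Set (c₁ ⊔ ℓ₁ ⊔ ℓ₂) where
    field
      cong   : ∀ {a b} → a H.≈ b → θ a B.≈ θ b
      homo   : ∀ a b → θ (a H.∙ b) B.≈ (θ a B.∙ θ b)
      ε-homo : θ H.ε B.≈ B.ε

  record IsTransferHom (θ : H.Carrier → B.Carrier) : Set (c₁ ⊔ ℓ₁ ⊔ c₂ ⊔ ℓ₂) where
    field
      isMonoidHom : IsMonoidHom θ
      T1-surj  : ∀ b → ∃[ a ] ∃[ e ] (IsUnit B e × b B.≈ (θ a B.∙ e))
      T1-units⁻¹ : ∀ a → IsUnit B (θ a) → IsUnit H a
      T1-units   : ∀ a → IsUnit H a → IsUnit B (θ a)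
      T2 : ∀ u b d → θ u B.≈ (b B.∙ d) →
           ∃[ v ] ∃[ w ] (u H.≈ (v H.∙ w) ×
             (∃[ e ] (IsUnit B e × θ v B.≈ (b B.∙ e))) ×
             (∃[ e ] (IsUnit B e × θ w B.≈ (d B.∙ e))))

{-# OPTIONS --safe #-}

-- Fix A ∈ H with a positive element, and let M bound the elements of A. For k large,
-- removing from the sumset kA the elements of a window (l, G) does not change its sum
-- with kA when l = 0, nor its sum with itself when T + M ≤ l and G ≤ l + 1 + T: a sum
-- y₁ + y₂ of elements of kA with y₁ in the window is regrouped by moving a partial sum
-- of y₂ of size in [T, T + M] over to y₁. Such truncations thus divide (2k)A and lie in H.
--  * F = kA ∖ (l, G) satisfies 2F = 2(kA) but F ≠ kA, so H is not torsion-free.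
--  * D_G = kA ∖ (0, G) divides (2k)A, while its positive elements are all at least G;
--    finitely many generators of [[A]] bound the least positive element of
--    everything they generate, so [[A]] is not finitely generated.
--  * D_G + kA = kA + kA, so a transfer homomorphism θ to a cancellative monoid has
--    θ(D_G) = kθ(A). Lifting the k non-unit factors θ(A) through (T2) produces an
--    element of D_G of size at least kG > kM, but D_G ⊆ kA ⊆ [0, kM].
module Submission where

open import Defs
open import Level using (Level; 0ℓ)
open import Data.Nat using (ℕ; zero; suc; _+_; _*_; _≤_; _<_; z≤n; s≤s; _≤?_; >-nonZero)
open import Data.Nat.Properties
open import Algebra.Properties.CommutativeSemigroup +-commutativeSemigroup using (x∙yz≈y∙xz)
open import Data.List using (List; []; _∷_; filter; cartesianProductWith)
open import Data.List.Extrema.Nat using (max; xs≤max)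
import Data.List.Relation.Unary.All as All
open import Data.List.Membership.Propositional using (_∈_)
open import Data.List.Membership.Propositional.Properties
  using (∈-cartesianProductWith⁺; ∈-cartesianProductWith⁻; ∈-filter⁺; ∈-filter⁻)
open import Data.List.Relation.Unary.Any using (here; there)
open import Data.Vec using (Vec; []; _∷_)
open import Data.Product using (Σ; ∃; ∃₂; ∃-syntax; _×_; _,_; proj₁; proj₂)
open import Data.Sum using (_⊎_; inj₁; inj₂)
open import Data.Empty using (⊥-elim)
open import Relation.Nullary using (¬_; yes; no)
open import Relation.Nullary.Decidable using (_⊎-dec_)
open import Relation.Unary using (Decidable)
open import Relation.Binary.Bundles using (Setoid)
import Relation.Binary.Reasoning.Setoid as SetoidReasoning
open import Relation.Binary.PropositionalEquality using (_≡_; refl; sym; trans; cong; subst)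
open import Algebra.Bundles using (CommutativeMonoid)

∈⇒≤max : ∀ {x xs} → x ∈ xs → x ≤ max 0 xs
∈⇒≤max = All.lookup (xs≤max 0 _)

Outside : ℕ → ℕ → ℕ → Set
Outside l G x = x ≤ l ⊎ G ≤ x

outside? : ∀ l G → Decidable (Outside l G)
outside? l G x = (x ≤? l) ⊎-dec (G ≤? x)

¬outside⇒between : ∀ {l G x} → ¬ Outside l G x → l < x × x < G
¬outside⇒between ¬o = ≰⇒> (λ x≤l → ¬o (inj₁ x≤l)) , ≰⇒> (λ G≤x → ¬o (inj₂ G≤x))

between⇒¬outside : ∀ {l G x} → l < x → x < G → ¬ Outside l G x
between⇒¬outside l<x _   (inj₁ x≤l) = <⇒≱ l<x x≤l
between⇒¬outside _   x<G (inj₂ G≤x) = <⇒≱ x<G G≤x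

data SumOf (xs : List ℕ) : ℕ → ℕ → Set where
  []  : SumOf xs 0 0
  _∷_ : ∀ {k x y} → x ∈ xs → SumOf xs k y → SumOf xs (suc k) (x + y)

module _ {xs : List ℕ} where

  SumOf-+ : ∀ {k l y z} → SumOf xs k y → SumOf xs l z → SumOf xs (k + l) (y + z)
  SumOf-+ [] t = t
  SumOf-+ {z = z} (_∷_ {x = x} {y} x∈ s) t rewrite +-assoc x y z = x∈ ∷ SumOf-+ s t

  SumOf-split : ∀ k {l y} → SumOf xs (k + l) y →
                ∃₂ λ y₁ y₂ → y ≡ y₁ + y₂ × SumOf xs k y₁ × SumOf xs l y₂
  SumOf-split zero s = 0 , _ , refl , [] , s
  SumOf-split (suc k) (_∷_ {x = x} x∈ s) with SumOf-split k s
  ... | y₁ , y₂ , refl , s₁ , s₂ = x + y₁ , y₂ , sym (+-assoc x y₁ y₂) , x∈ ∷ s₁ , s₂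

  SumOf-≤ : ∀ {M k y} → (∀ {x} → x ∈ xs → x ≤ M) → SumOf xs k y → y ≤ k * M
  SumOf-≤ ≤M [] = z≤n
  SumOf-≤ ≤M (x∈ ∷ s) = +-mono-≤ (≤M x∈) (SumOf-≤ ≤M s)

  SumOf-replicate : ∀ {x} k → x ∈ xs → SumOf xs k (k * x)
  SumOf-replicate zero    x∈ = []
  SumOf-replicate (suc k) x∈ = x∈ ∷ SumOf-replicate k x∈

  module _ (0∈xs : 0 ∈ xs) where

    SumOf-0 : ∀ k → SumOf xs k 0
    SumOf-0 zero    = []
    SumOf-0 (suc k) = 0∈xs ∷ SumOf-0 k

    SumOf-recount : ∀ {n j y} → SumOf xs n y → y ≤ j → SumOf xs j y
    SumOf-recount {j = j} [] _ = SumOf-0 j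
    SumOf-recount (_∷_ {x = zero} _ s) y≤j = SumOf-recount s y≤j
    SumOf-recount {j = suc j} (_∷_ {x = suc x} {y} x∈ s) (s≤s x+y≤j) =
      x∈ ∷ SumOf-recount s (≤-trans (m≤n+m y x) x+y≤j)

    -- A sum y ≥ T has a subsum in [T, T + M]: add summands until T is passed.
    SumOf-splitAbove : ∀ {M n y} T → (∀ {x} → x ∈ xs → x ≤ M) → T ≤ y → SumOf xs n y →
      ∃₂ λ u v → y ≡ u + v × T ≤ u × u ≤ T + M × SumOf xs n u × SumOf xs n v
    SumOf-splitAbove T ≤M T≤0 [] = 0 , 0 , refl , T≤0 , z≤n , [] , []
    SumOf-splitAbove {M} T ≤M T≤x+y (_∷_ {x = x} {y} x∈ s) with T ≤? y
    ... | no T≰y = x + y , 0 , sym (+-identityʳ _) , T≤x+y ,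
      ≤-trans (+-mono-≤ (≤M x∈) (<⇒≤ (≰⇒> T≰y))) (≤-reflexive (+-comm M T)) , x∈ ∷ s , SumOf-0 _
    ... | yes T≤y with SumOf-splitAbove T ≤M T≤y s
    ...   | u , v , refl , T≤u , u≤T+M , sᵤ , sᵥ =
      u , x + v , x∙yz≈y∙xz x u v , T≤u , u≤T+M , 0∈xs ∷ sᵤ , x∈ ∷ sᵥ

module Pfin0Properties (N : NumericalMonoid) where
  open FinSet0

  infixl 6 _+ₛ_
  infix 4 _≈ₛ_

  _+ₛ_ : FinSet0 N → FinSet0 N → FinSet0 N
  _+ₛ_ = _⊕_ N

  _≈ₛ_ : FinSet0 N → FinSet0 N → Set
  _≈ₛ_ = _≋_ N

  𝟎 : FinSet0 N
  𝟎 = zeroSet N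

  ≈ₛ-setoid : Setoid 0ℓ 0ℓ
  ≈ₛ-setoid = record
    { Carrier = FinSet0 N
    ; _≈_ = _≈ₛ_
    ; isEquivalence = record
      { refl  = λ _ → (λ p → p) , (λ p → p)
      ; sym   = λ X≈Y n → proj₂ (X≈Y n) , proj₁ (X≈Y n)
      ; trans = λ X≈Y Y≈Z n → (λ p → proj₁ (Y≈Z n) (proj₁ (X≈Y n) p))
                            , (λ p → proj₂ (X≈Y n) (proj₂ (Y≈Z n) p))
      }
    }

  module ≈ₛ = Setoid ≈ₛ-setoid

  ∈-+ₛ⁺ : ∀ {xs ys x y} → x ∈ xs → y ∈ ys → x + y ∈ cartesianProductWith _+_ xs ys
  ∈-+ₛ⁺ = ∈-cartesianProductWith⁺ _+_

  ∈-+ₛ⁻ : ∀ X Y {z} → z ∈ elems (X +ₛ Y) →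
          ∃₂ λ x y → x ∈ elems X × y ∈ elems Y × z ≡ x + y
  ∈-+ₛ⁻ X Y = ∈-cartesianProductWith⁻ _+_ (elems X) (elems Y)

  ∈-+ₛ⁺ˡ : ∀ {x} X Y → x ∈ elems X → x ∈ elems (X +ₛ Y)
  ∈-+ₛ⁺ˡ {x} X Y x∈ = subst (_∈ elems (X +ₛ Y)) (+-identityʳ x) (∈-+ₛ⁺ x∈ (0∈ Y))

  +ₛ-identityʳ : ∀ X → X +ₛ 𝟎 ≈ₛ X
  +ₛ-identityʳ X z = ⊆X , ∈-+ₛ⁺ˡ X 𝟎
    where
    ⊆X : z ∈ elems (X +ₛ 𝟎) → z ∈ elems X
    ⊆X p with ∈-+ₛ⁻ X 𝟎 p
    ... | x , .0 , x∈ , here refl , refl = subst (_∈ elems X) (sym (+-identityʳ x)) x∈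

  +ₛ-congˡ : ∀ X {Y Y′} → Y ≈ₛ Y′ → X +ₛ Y ≈ₛ X +ₛ Y′
  +ₛ-congˡ X {Y} {Y′} Y≈Y′ z = ⊆ Y Y′ Y≈Y′ , ⊆ Y′ Y (≈ₛ.sym {Y} {Y′} Y≈Y′)
    where
    ⊆ : ∀ Y Y′ → Y ≈ₛ Y′ → z ∈ elems (X +ₛ Y) → z ∈ elems (X +ₛ Y′)
    ⊆ Y Y′ Y≈Y′ p with ∈-+ₛ⁻ X Y p
    ... | x , y , x∈ , y∈ , refl = ∈-+ₛ⁺ x∈ (proj₁ (Y≈Y′ y) y∈)

  Trivial : FinSet0 N → Set
  Trivial X = ∀ {x} → x ∈ elems X → x ≡ 0

  trivial⊎positive : ∀ X → Trivial X ⊎ ∃ λ p → p ∈ elems X × 0 < p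
  trivial⊎positive X = go (elems X)
    where
    go : ∀ xs → (∀ {x} → x ∈ xs → x ≡ 0) ⊎ ∃ λ p → p ∈ xs × 0 < p
    go []            = inj₁ λ ()
    go (suc x ∷ xs)  = inj₂ (suc x , here refl , s≤s z≤n)
    go (zero  ∷ xs) with go xs
    ... | inj₁ zeros        = inj₁ λ { (here refl) → refl ; (there p) → zeros p }
    ... | inj₂ (p , p∈ , q) = inj₂ (p , there p∈ , q)

  trivial⇒≈𝟎 : ∀ {X} → Trivial X → X ≈ₛ 𝟎
  trivial⇒≈𝟎 {X} zeros z = (λ p → subst (_∈ elems 𝟎) (sym (zeros p)) (here refl))
                         , λ { (here refl) → 0∈ X }

  ≉𝟎⇒positive : ∀ X → ¬ X ≈ₛ 𝟎 → ∃ λ p → p ∈ elems X × 0 < p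
  ≉𝟎⇒positive X X≉𝟎 with trivial⊎positive X
  ... | inj₁ zeros    = ⊥-elim (X≉𝟎 (trivial⇒≈𝟎 {X} zeros))
  ... | inj₂ positive = positive

  trivial-+ₛ : ∀ {X Y} → Trivial X → Trivial Y → Trivial (X +ₛ Y)
  trivial-+ₛ {X} {Y} zerosˣ zerosʸ p with ∈-+ₛ⁻ X Y p
  ... | x , y , x∈ , y∈ , refl rewrite zerosˣ x∈ | zerosʸ y∈ = refl

  dropBetween : ℕ → ℕ → FinSet0 N → FinSet0 N
  dropBetween l G X = mkFinSet0 (filter (outside? l G) (elems X))
    (λ p → ⊆S X (proj₁ (∈-filter⁻ (outside? l G) p)))
    (∈-filter⁺ (outside? l G) (0∈ X) (inj₁ z≤n))

  ∈-dropBetween⁺ : ∀ {l G X x} → x ∈ elems X → Outside l G x → x ∈ elems (dropBetween l G X)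
  ∈-dropBetween⁺ {l} {G} = ∈-filter⁺ (outside? l G)

  ∈-dropBetween⁻ : ∀ {l G X x} → x ∈ elems (dropBetween l G X) → x ∈ elems X × Outside l G x
  ∈-dropBetween⁻ {l} {G} = ∈-filter⁻ (outside? l G)

  bound : FinSet0 N → ℕ
  bound X = max 0 (elems X)

  MinPositive≤ : ℕ → FinSet0 N → Set
  MinPositive≤ b X = Trivial X ⊎ ∃ λ p → p ∈ elems X × 0 < p × p ≤ b

  MinPositive≤-mono : ∀ {b b′ X} → b ≤ b′ → MinPositive≤ b X → MinPositive≤ b′ X
  MinPositive≤-mono _    (inj₁ zeros)               = inj₁ zeros
  MinPositive≤-mono b≤b′ (inj₂ (p , p∈ , 0<p , p≤b)) = inj₂ (p , p∈ , 0<p , ≤-trans p≤b b≤b′)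

  MinPositive≤-resp : ∀ {b X Y} → X ≈ₛ Y → MinPositive≤ b X → MinPositive≤ b Y
  MinPositive≤-resp X≈Y (inj₁ zeros)               = inj₁ λ {y} y∈ → zeros (proj₂ (X≈Y y) y∈)
  MinPositive≤-resp X≈Y (inj₂ (p , p∈ , 0<p , p≤b)) = inj₂ (p , proj₁ (X≈Y p) p∈ , 0<p , p≤b)

  MinPositive≤-+ₛ : ∀ {b} X Y → MinPositive≤ b X → MinPositive≤ b Y → MinPositive≤ b (X +ₛ Y)
  MinPositive≤-+ₛ X Y (inj₂ (p , p∈ , q)) _ = inj₂ (p , ∈-+ₛ⁺ˡ X Y p∈ , q)
  MinPositive≤-+ₛ X Y (inj₁ _) (inj₂ (p , p∈ , q)) = inj₂ (p , ∈-+ₛ⁺ {x = 0} (0∈ X) p∈ , q)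
  MinPositive≤-+ₛ X Y (inj₁ zerosˣ) (inj₁ zerosʸ) = inj₁ (trivial-+ₛ {X} {Y} zerosˣ zerosʸ)

  MinPositive≤-bound : ∀ X → MinPositive≤ (bound X) X
  MinPositive≤-bound X with trivial⊎positive X
  ... | inj₁ zeros           = inj₁ zeros
  ... | inj₂ (p , p∈ , 0<p) = inj₂ (p , p∈ , 0<p , ∈⇒≤max p∈)

  MinPositive≤-gap : ∀ {b G X} → MinPositive≤ b X → (∀ {x} → x ∈ elems X → Outside 0 G x) →
                     b < G → Trivial X
  MinPositive≤-gap (inj₁ zeros) _ _ = zeros
  MinPositive≤-gap (inj₂ (p , p∈ , 0<p , p≤b)) outside b<G with outside p∈
  ... | inj₁ p≤0 = ⊥-elim (<⇒≱ 0<p p≤0)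
  ... | inj₂ G≤p = ⊥-elim (<⇒≱ (≤-<-trans p≤b b<G) G≤p)

  times : ℕ → FinSet0 N → FinSet0 N
  times zero    X = 𝟎
  times (suc k) X = X +ₛ times k X

  MinPositive≤-times : ∀ n X → MinPositive≤ (bound X) (times n X)
  MinPositive≤-times zero    X = inj₁ λ { (here refl) → refl }
  MinPositive≤-times (suc n) X = MinPositive≤-+ₛ X (times n X) (MinPositive≤-bound X) (MinPositive≤-times n X)

  module Multiples (A : FinSet0 N) where

    SumOf⇒∈times : ∀ {k y} → SumOf (elems A) k y → y ∈ elems (times k A)
    SumOf⇒∈times []         = here refl
    SumOf⇒∈times (x∈ ∷ s) = ∈-+ₛ⁺ x∈ (SumOf⇒∈times s)

    ∈times⇒SumOf : ∀ k {y} → y ∈ elems (times k A) → SumOf (elems A) k y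
    ∈times⇒SumOf zero    (here refl) = []
    ∈times⇒SumOf (suc k) p with ∈-+ₛ⁻ A (times k A) p
    ... | x , y , x∈ , y∈ , refl = x∈ ∷ ∈times⇒SumOf k y∈

    +ₛ-⊆-times : ∀ {k l z} X Y → (∀ {x} → x ∈ elems X → SumOf (elems A) k x) →
                 (∀ {y} → y ∈ elems Y → SumOf (elems A) l y) →
                 z ∈ elems (X +ₛ Y) → z ∈ elems (times (k + l) A)
    +ₛ-⊆-times X Y sumˣ sumʸ p with ∈-+ₛ⁻ X Y p
    ... | x , y , x∈ , y∈ , refl = SumOf⇒∈times (SumOf-+ (sumˣ x∈) (sumʸ y∈))

    times-+ : ∀ k l → times k A +ₛ times l A ≈ₛ times (k + l) A
    times-+ k l z = +ₛ-⊆-times (times k A) (times l A) (∈times⇒SumOf k) (∈times⇒SumOf l) , ⊇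
      where
      ⊇ : z ∈ elems (times (k + l) A) → z ∈ elems (times k A +ₛ times l A)
      ⊇ p with SumOf-split k (∈times⇒SumOf (k + l) p)
      ... | y₁ , y₂ , refl , s₁ , s₂ = ∈-+ₛ⁺ (SumOf⇒∈times s₁) (SumOf⇒∈times s₂)

    private
      Sum = SumOf (elems A)
      ≤bound : ∀ {x} → x ∈ elems A → x ≤ bound A
      ≤bound = ∈⇒≤max

    SumOf⇒∈dropBetween : ∀ {l G k y} → Sum k y → Outside l G y →
                         y ∈ elems (dropBetween l G (times k A))
    SumOf⇒∈dropBetween {l} {G} {k} s = ∈-dropBetween⁺ {l} {G} {times k A} (SumOf⇒∈times s)

    ∈dropBetween⇒SumOf : ∀ {l G} k {y} → y ∈ elems (dropBetween l G (times k A)) → Sum k y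
    ∈dropBetween⇒SumOf {l} {G} k p = ∈times⇒SumOf k (proj₁ (∈-dropBetween⁻ {l} {G} {times k A} p))

    dropBetween-0-+ₛ-times : ∀ {G k} → G + G ≤ k →
      dropBetween 0 G (times k A) +ₛ times k A ≈ₛ times (k + k) A
    dropBetween-0-+ₛ-times {G} {k} 2G≤k z =
      +ₛ-⊆-times D (times k A) (∈dropBetween⇒SumOf k) (∈times⇒SumOf k) , ⊇
      where
      D = dropBetween 0 G (times k A)
      ⊇ : z ∈ elems (times (k + k) A) → z ∈ elems (D +ₛ times k A)
      ⊇ p with SumOf-split k (∈times⇒SumOf (k + k) p)
      ... | y₁ , y₂ , refl , s₁ , s₂ with outside? 0 G y₁ | outside? 0 G y₂
      ... | yes o₁ | _ = ∈-+ₛ⁺ (SumOf⇒∈dropBetween s₁ o₁) (SumOf⇒∈times s₂)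
      ... | no _ | yes o₂ = subst (_∈ elems (D +ₛ times k A)) (+-comm y₂ y₁)
                              (∈-+ₛ⁺ (SumOf⇒∈dropBetween s₂ o₂) (SumOf⇒∈times s₁))
      ... | no ¬o₁ | no ¬o₂ = ∈-+ₛ⁺ {x = 0} (0∈ D) (SumOf⇒∈times (SumOf-recount (0∈ A) (SumOf-+ s₁ s₂)
          (≤-trans (<⇒≤ (+-mono-< (proj₂ (¬outside⇒between ¬o₁)) (proj₂ (¬outside⇒between ¬o₂)))) 2G≤k)))

    module _ {l G T k : ℕ} (T+M≤l : T + bound A ≤ l) (G≤1+l+T : G ≤ suc l + T)
             (k-large : G + (T + bound A) + G ≤ k) where
      private
        M = bound A
        F = dropBetween l G (times k A)

        G+T+M≤k : G + (T + M) ≤ k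
        G+T+M≤k = ≤-trans (m≤m+n (G + (T + M)) G) k-large

        -- Split off a subsum in [T, T + M]; both parts then lie below the gap.
        SumOf⇒∈F+F : ∀ {y} → Sum k y → y ∈ elems (F +ₛ F)
        SumOf⇒∈F+F {y} s with outside? l G y
        ... | yes o = ∈-+ₛ⁺ˡ F F (SumOf⇒∈dropBetween s o)
        ... | no ¬o with ¬outside⇒between ¬o
        ...   | l<y , y<G
                with SumOf-splitAbove (0∈ A) T ≤bound (≤-trans (m≤m+n T M) (≤-trans T+M≤l (<⇒≤ l<y))) s
        ...     | u , v , refl , T≤u , u≤T+M , sᵤ , sᵥ =
                  ∈-+ₛ⁺ (SumOf⇒∈dropBetween sᵤ (inj₁ (≤-trans u≤T+M T+M≤l)))
                        (SumOf⇒∈dropBetween sᵥ (inj₁ v≤l))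
          where
          open ≤-Reasoning
          v≤l : v ≤ l
          v≤l = ≤-pred (+-cancelʳ-< u v (suc l) (begin-strict
            v + u      ≡⟨ +-comm v u ⟩
            u + v      <⟨ y<G ⟩
            G          ≤⟨ G≤1+l+T ⟩
            suc l + T  ≤⟨ +-monoʳ-≤ (suc l) T≤u ⟩
            suc l + u  ∎))

        between+SumOf⇒∈F+F : ∀ {y₁ y₂} → l < y₁ × y₁ < G → Sum k y₁ → Sum k y₂ →
                             y₁ + y₂ ∈ elems (F +ₛ F)
        between+SumOf⇒∈F+F {y₁} {y₂} (l<y₁ , y₁<G) s₁ s₂ with T ≤? y₂
        ... | no T≰y₂ = SumOf⇒∈F+F (SumOf-recount (0∈ A) (SumOf-+ s₁ s₂)
                (≤-trans (<⇒≤ (+-mono-< y₁<G (≰⇒> T≰y₂)))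
                         (≤-trans (+-monoʳ-≤ G (m≤m+n T M)) G+T+M≤k)))
        ... | yes T≤y₂ with SumOf-splitAbove (0∈ A) T ≤bound T≤y₂ s₂
        ...   | u , v , refl , T≤u , u≤T+M , sᵤ , sᵥ with outside? l G v
        ...     | no ¬oᵥ = SumOf⇒∈F+F (SumOf-recount (0∈ A) (SumOf-+ s₁ s₂)
                    (≤-trans (+-mono-≤ (<⇒≤ y₁<G)
                                       (+-mono-≤ u≤T+M (<⇒≤ (proj₂ (¬outside⇒between ¬oᵥ)))))
                             (≤-trans (≤-reflexive (sym (+-assoc G (T + M) G))) k-large)))
        ...     | yes oᵥ = subst (_∈ elems (F +ₛ F)) (+-assoc y₁ u v)
                    (∈-+ₛ⁺ (SumOf⇒∈dropBetween (SumOf-recount (0∈ A) (SumOf-+ s₁ sᵤ) y₁+u≤k)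
                                               (inj₂ G≤y₁+u))
                           (SumOf⇒∈dropBetween sᵥ oᵥ))
          where
          y₁+u≤k : y₁ + u ≤ k
          y₁+u≤k = ≤-trans (+-mono-≤ (<⇒≤ y₁<G) u≤T+M) G+T+M≤k
          G≤y₁+u : G ≤ y₁ + u
          G≤y₁+u = ≤-trans G≤1+l+T (+-mono-≤ l<y₁ T≤u)

      dropBetween-+ₛ-self : dropBetween l G (times k A) +ₛ dropBetween l G (times k A) ≈ₛ times (k + k) A
      dropBetween-+ₛ-self z = +ₛ-⊆-times F F (∈dropBetween⇒SumOf k) (∈dropBetween⇒SumOf k) , ⊇
        where
        ⊇ : z ∈ elems (times (k + k) A) → z ∈ elems (F +ₛ F)
        ⊇ p with SumOf-split k (∈times⇒SumOf (k + k) p)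
        ... | y₁ , y₂ , refl , s₁ , s₂ with outside? l G y₁ | outside? l G y₂
        ... | yes o₁ | yes o₂ = ∈-+ₛ⁺ (SumOf⇒∈dropBetween s₁ o₁) (SumOf⇒∈dropBetween s₂ o₂)
        ... | no ¬o₁ | _      = between+SumOf⇒∈F+F (¬outside⇒between ¬o₁) s₁ s₂
        ... | yes _  | no ¬o₂ = subst (_∈ elems (F +ₛ F)) (+-comm y₂ y₁)
                                  (between+SumOf⇒∈F+F (¬outside⇒between ¬o₂) s₂ s₁)

    SumOf-between : ∀ {a l G k} → a ∈ elems A → 0 < a → suc l ≤ k → suc l + bound A < G →
                    ∃ λ x → Sum k x × l < x × x < G
    SumOf-between {a} {l} {G} {k} a∈ 0<a 1+l≤k 1+l+M<G
      with SumOf-splitAbove (0∈ A) (suc l) ≤bound 1+l≤ka (SumOf-replicate k a∈)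
      where
      1+l≤ka : suc l ≤ k * a
      1+l≤ka = ≤-trans 1+l≤k (m≤m*n k a {{>-nonZero 0<a}})
    ... | u , _ , _ , 1+l≤u , u≤1+l+M , sᵤ , _ = u , sᵤ , 1+l≤u , ≤-<-trans u≤1+l+M 1+l+M<G

module UnitProperties {c ℓ : Level} (B : CommutativeMonoid c ℓ) where
  open CommutativeMonoid B renaming (refl to ≈-refl; sym to ≈-sym; trans to ≈-trans)
  open import Algebra.Properties.CommutativeSemigroup commutativeSemigroup using (interchange)

  private
    Unit = IsUnit rawMonoid

  isUnit-resp : ∀ {x y} → x ≈ y → Unit x → Unit y
  isUnit-resp x≈y (i , xi≈ε) = i , ≈-trans (∙-cong (≈-sym x≈y) ≈-refl) xi≈ε

  isUnit-∙ : ∀ {x y} → Unit x → Unit y → Unit (x ∙ y)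
  isUnit-∙ {x} {y} (i , xi≈ε) (j , yj≈ε) =
    i ∙ j , ≈-trans (interchange x y i j) (≈-trans (∙-cong xi≈ε yj≈ε) (identityˡ ε))

  isUnit-∙⇒isUnitˡ : ∀ {x y} → Unit (x ∙ y) → Unit x
  isUnit-∙⇒isUnitˡ {x} {y} (i , xyi≈ε) = y ∙ i , ≈-trans (≈-sym (assoc x y i)) xyi≈ε

module Submonoid (N : NumericalMonoid) {H : FinSet0 N → Set} (hH : IsDivClosedSubmonoid N H) where
  open FinSet0
  open Pfin0Properties N
  open IsDivClosedSubmonoid hH

  private
    SM = SubMonoid N H hH
    Elem = Σ (FinSet0 N) H

  ·≡times : ∀ k (X : Elem) → proj₁ (_·_ SM k X) ≡ times k (proj₁ X)
  ·≡times zero    X = refl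
  ·≡times (suc k) X = cong (proj₁ X +ₛ_) (·≡times k X)

  times∈H : ∀ {X} → H X → ∀ k → H (times k X)
  times∈H hX zero    = ε∈
  times∈H hX (suc k) = ∙-closed hX (times∈H hX k)

  power : ∀ {X} → H X → ℕ → Elem
  power {X} hX k = times k X , times∈H hX k

  isUnit⇒trivial : ∀ u → IsUnit SM u → Trivial (proj₁ u)
  isUnit⇒trivial (U , _) ((V , _) , U+V≈𝟎) {x} x∈ with proj₁ (U+V≈𝟎 (x + 0)) (∈-+ₛ⁺ x∈ (0∈ V))
  ... | here x+0≡0 = trans (sym (+-identityʳ x)) x+0≡0

  trivial⇒isUnit : ∀ u → Trivial (proj₁ u) → IsUnit SM u
  trivial⇒isUnit (U , _) zeros =
    (𝟎 , ε∈) , ≈ₛ.trans {U +ₛ 𝟎} {U} {𝟎} (+ₛ-identityʳ U) (trivial⇒≈𝟎 {U} zeros)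

  boundSum : ∀ {k} → Vec Elem k → ℕ
  boundSum []       = 0
  boundSum (g ∷ gs) = bound (proj₁ g) + boundSum gs

  MinPositive≤-lincomb : ∀ {k} (ns : Vec ℕ k) gs → MinPositive≤ (boundSum gs) (proj₁ (lincomb SM ns gs))
  MinPositive≤-lincomb []       []       = inj₁ λ { (here refl) → refl }
  MinPositive≤-lincomb (n ∷ ns) (g ∷ gs) =
    MinPositive≤-+ₛ (proj₁ (_·_ SM n g)) (proj₁ (lincomb SM ns gs))
      (MinPositive≤-mono {X = proj₁ (_·_ SM n g)} (m≤m+n _ _)
        (subst (MinPositive≤ _) (sym (·≡times n g)) (MinPositive≤-times n (proj₁ g))))
      (MinPositive≤-mono {X = proj₁ (lincomb SM ns gs)} (m≤n+m _ _) (MinPositive≤-lincomb ns gs))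

  module Transfer {c ℓ : Level} (B : CommutativeMonoid c ℓ) {θ : Elem → CommutativeMonoid.Carrier B}
                  (transfer : IsTransferHom SM (CommutativeMonoid.rawMonoid B) θ) where
    open CommutativeMonoid B renaming (refl to ≈-refl; sym to ≈-sym; trans to ≈-trans)
    open UnitProperties B
    open IsTransferHom transfer
    open IsMonoidHom isMonoidHom renaming (cong to θ-cong)

    infixr 8 _·ᴮ_
    _·ᴮ_ : ℕ → Carrier → Carrier
    _·ᴮ_ = _·_ rawMonoid

    θ-power : ∀ {X} (hX : H X) k → θ (power hX k) ≈ k ·ᴮ θ (X , hX)
    θ-power hX zero    = ε-homo
    θ-power hX (suc k) = ≈-trans (homo _ (power hX k)) (∙-cong ≈-refl (θ-power hX k))

    -- Peel off one factor θ X̂ at a time with (T2); the part of U lifting it is not a unit,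
    -- so it contributes a positive element, which is at least G.
    transfer-lowerBound : ∀ X̂ → ¬ IsUnit rawMonoid (θ X̂) → ∀ {G} n U e → IsUnit rawMonoid e →
      θ U ≈ n ·ᴮ θ X̂ ∙ e → (∀ {x} → x ∈ elems (proj₁ U) → Outside 0 G x) →
      ∃ λ x → x ∈ elems (proj₁ U) × n * G ≤ x
    transfer-lowerBound X̂ _ zero U _ _ _ _ = 0 , 0∈ (proj₁ U) , z≤n
    transfer-lowerBound X̂ nonunit {G} (suc n) U e e-unit θU≈ gapU
      with T2 U (θ X̂) (n ·ᴮ θ X̂ ∙ e) (≈-trans θU≈ (assoc _ _ e))
    ... | v , w , U≈v+w , (e₁ , _ , θv≈) , (e₂ , e₂-unit , θw≈) with trivial⊎positive (proj₁ v)
    ...   | inj₁ zeros =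
            ⊥-elim (nonunit (isUnit-∙⇒isUnitˡ (isUnit-resp θv≈ (T1-units v (trivial⇒isUnit v zeros)))))
    ...   | inj₂ (p , p∈v , 0<p)
            with transfer-lowerBound X̂ nonunit n w (e ∙ e₂) (isUnit-∙ e-unit e₂-unit)
                   (≈-trans θw≈ (assoc _ e e₂))
                   (λ y∈w → gapU (proj₂ (U≈v+w _) (∈-+ₛ⁺ {x = 0} (0∈ (proj₁ v)) y∈w)))
    ...     | x , x∈w , nG≤x = p + x , proj₂ (U≈v+w _) (∈-+ₛ⁺ p∈v x∈w) , +-mono-≤ G≤p nG≤x
      where
      G≤p : G ≤ p
      G≤p with gapU (proj₂ (U≈v+w p) (∈-+ₛ⁺ˡ (proj₁ v) (proj₁ w) p∈v))
      ... | inj₁ p≤0 = ⊥-elim (<⇒≱ 0<p p≤0)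
      ... | inj₂ G≤p = G≤p

  module _ {A : FinSet0 N} (hA : H A) {a : ℕ} (a∈A : a ∈ elems A) (0<a : 0 < a) where
    open Multiples A

    ¬torsionFree : ¬ TorsionFree SM
    ¬torsionFree torsionFree =
      let x , sₓ , l<x , x<G = SumOf-between a∈A 0<a 1+l≤k (+-monoʳ-< (suc l) (n<1+n M))
          x∈F = proj₂ (torsionFree (F , F∈H) (power hA k) 2 (s≤s z≤n) 2F≈2kA x) (SumOf⇒∈times sₓ)
      in between⇒¬outside l<x x<G (proj₂ (∈-dropBetween⁻ {l} {G} {times k A} x∈F))
      where
      M = bound A
      T = suc M
      l = T + M
      G = suc l + T
      k = G + (T + M) + G
      1+l≤k : suc l ≤ k
      1+l≤k = ≤-trans (m≤m+n (suc l) T) (≤-trans (m≤m+n G (T + M)) (m≤m+n (G + (T + M)) G))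
      F = dropBetween l G (times k A)
      F+F≈2kA : F +ₛ F ≈ₛ times (k + k) A
      F+F≈2kA = dropBetween-+ₛ-self ≤-refl ≤-refl ≤-refl
      F∈H : H F
      F∈H = divClosed {times (k + k) A} {F} {F} (times∈H hA (k + k))
                      (≈ₛ.sym {F +ₛ F} {times (k + k) A} F+F≈2kA)
      2F≈2kA : F +ₛ (F +ₛ 𝟎) ≈ₛ times k A +ₛ (times k A +ₛ 𝟎)
      2F≈2kA = begin
        F +ₛ (F +ₛ 𝟎)                  ≈⟨ +ₛ-congˡ F {F +ₛ 𝟎} {F} (+ₛ-identityʳ F) ⟩
        F +ₛ F                         ≈⟨ F+F≈2kA ⟩
        times (k + k) A                ≈⟨ times-+ k k ⟨
        times k A +ₛ times k A         ≈⟨ +ₛ-congˡ (times k A) {times k A +ₛ 𝟎} {times k A}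
                                                    (+ₛ-identityʳ (times k A)) ⟨
        times k A +ₛ (times k A +ₛ 𝟎)  ∎
        where open SetoidReasoning ≈ₛ-setoid

    private
      module Truncated (G : ℕ) where
        k = G + G
        D = dropBetween 0 G (times k A)

        2kA≈D+kA : times (k + k) A ≈ₛ D +ₛ times k A
        2kA≈D+kA = ≈ₛ.sym {D +ₛ times k A} {times (k + k) A} (dropBetween-0-+ₛ-times {G} {k} ≤-refl)

        D∈H : H D
        D∈H = divClosed {times (k + k) A} {D} {times k A} (times∈H hA (k + k)) 2kA≈D+kA

        D-gap : ∀ {x} → x ∈ elems D → Outside 0 G x
        D-gap x∈ = proj₂ (∈-dropBetween⁻ {0} {G} {times k A} x∈)

    ¬locallyFinitelyGenerated : ¬ LocallyFinitelyGenerated SM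
    ¬locallyFinitelyGenerated lfg with lfg (A , hA)
    ... | _ , gs , _ , generates = <⇒≱ (≤-trans (s≤s z≤n) k≤ka) (≤-reflexive (D-trivial ka∈D))
      where
      open Truncated (suc (boundSum gs))
      D∈⟦A⟧ : InDivHull SM (A , hA) (D , D∈H)
      D∈⟦A⟧ = k + k , power hA k , subst (_≈ₛ D +ₛ times k A) (sym (·≡times (k + k) (A , hA))) 2kA≈D+kA
      D-small : MinPositive≤ (boundSum gs) D
      D-small with generates (D , D∈H) D∈⟦A⟧
      ... | ns , u , u-unit , D≈L+u =
        MinPositive≤-resp {X = L +ₛ proj₁ u} {D} (≈ₛ.sym {D} {L +ₛ proj₁ u} D≈L+u)
          (MinPositive≤-+ₛ L (proj₁ u) (MinPositive≤-lincomb ns gs) (inj₁ (isUnit⇒trivial u u-unit)))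
        where L = proj₁ (lincomb SM ns gs)
      D-trivial : Trivial D
      D-trivial = MinPositive≤-gap {X = D} D-small D-gap ≤-refl
      k≤ka : k ≤ k * a
      k≤ka = m≤m*n k a {{>-nonZero 0<a}}
      ka∈D : k * a ∈ elems D
      ka∈D = SumOf⇒∈dropBetween (SumOf-replicate k a∈A) (inj₂ (≤-trans (m≤m+n _ _) k≤ka))

    ¬transferToCancellative : ∀ {c ℓ} (B : CommutativeMonoid c ℓ) → Cancellativeᶜ B →
      (θ : Elem → CommutativeMonoid.Carrier B) → ¬ IsTransferHom SM (CommutativeMonoid.rawMonoid B) θ
    ¬transferToCancellative B cancel θ transfer =
      let x , x∈D , kG≤x = transfer-lowerBound Â θÂ-nonunit k D̂ ε (ε , identityˡ ε) θD̂≈ D-gap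
          x≤kM = SumOf-≤ ∈⇒≤max (∈dropBetween⇒SumOf {0} k x∈D)
      in <⇒≱ (≤-<-trans x≤kM (*-monoʳ-< k (n<1+n M))) kG≤x
      where
      open CommutativeMonoid B renaming (refl to ≈-refl; sym to ≈-sym; trans to ≈-trans)
      open IsTransferHom transfer
      open IsMonoidHom isMonoidHom renaming (cong to θ-cong)
      open Transfer B transfer
      M = bound A
      open Truncated (suc M)
      Â = (A , hA)
      Âᵏ = power hA k
      D̂ = (D , D∈H)
      D+kA≈kA+kA : D +ₛ times k A ≈ₛ times k A +ₛ times k A
      D+kA≈kA+kA = ≈ₛ.trans {D +ₛ times k A} {times (k + k) A} {times k A +ₛ times k A}
                     (≈ₛ.sym {times (k + k) A} {D +ₛ times k A} 2kA≈D+kA)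
                     (≈ₛ.sym {times k A +ₛ times k A} {times (k + k) A} (times-+ k k))
      θÂ-nonunit : ¬ IsUnit rawMonoid (θ Â)
      θÂ-nonunit θÂ-unit = <⇒≢ 0<a (sym (isUnit⇒trivial Â (T1-units⁻¹ Â θÂ-unit) a∈A))
      θD̂≈ : θ D̂ ≈ k ·ᴮ θ Â ∙ ε
      θD̂≈ = ≈-trans (cancel (θ Âᵏ) (θ D̂) (θ Âᵏ) θÂᵏ∙θD̂≈θÂᵏ∙θÂᵏ)
                    (≈-trans (θ-power hA k) (≈-sym (identityʳ _)))
        where
        θÂᵏ∙θD̂≈θÂᵏ∙θÂᵏ : θ Âᵏ ∙ θ D̂ ≈ θ Âᵏ ∙ θ Âᵏ
        θÂᵏ∙θD̂≈θÂᵏ∙θÂᵏ =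
          ≈-trans (comm _ _)
            (≈-trans (≈-sym (homo D̂ Âᵏ)) (≈-trans (θ-cong D+kA≈kA+kA) (homo Âᵏ Âᵏ)))

theorem4p6 : {c ℓ : Level} (N : NumericalMonoid)
    (H : FinSet0 N → Set) (hH : IsDivClosedSubmonoid N H) →
    (∃[ A ] (H A × ¬ (_≋_ N A (zeroSet N)))) →
    ¬ TorsionFree (SubMonoid N H hH) ×
    ¬ LocallyFinitelyGenerated (SubMonoid N H hH) ×
    ((B : CommutativeMonoid c ℓ) → Cancellativeᶜ B →
      (θ : Σ (FinSet0 N) H → CommutativeMonoid.Carrier B) →
      ¬ IsTransferHom (SubMonoid N H hH) (CommutativeMonoid.rawMonoid B) θ)
theorem4p6 N H hH (A , hA , A≉𝟎) =
  let a , a∈A , 0<a = ≉𝟎⇒positive A A≉𝟎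
  in ¬torsionFree hA a∈A 0<a , ¬locallyFinitelyGenerated hA a∈A 0<a , ¬transferToCancellative hA a∈A 0<a
  where
  open Pfin0Properties N
  open Submonoid N hH
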